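{- For integers $p,q\ge1$ let $f(p,q)=q-1$ if $p=1$ and $f(p,q)=q(p-1)$ if $p\ge2$. Then: $\mathrm{Fix}(S(p,q))=f(p,q)$ for $p\ge1$, $q\ge2$; $\mathrm{Fix}(S_2(p_1,q_1,\dots,p_m,q_m))=\sum_{i=1}^m f(p_i,q_i)$ for $m\ge2$, $p_1>p_2>\cdots>p_m\ge1$, $q_i\ge1$; $\mathrm{Fix}(S_3(p,q_1,q_2))=f(p,q_1)+f(p+1,q_2)$ for $p\ge1$, $q_1\ge2$, $q_2\ge1$; and $\mathrm{Fix}(S_4(p,q))=f(p,2)+f(p+1,q)$ for $p\ge1$, $q\ge1$.
   Context: All graphs are finite and simple. A subset $S\subseteq V(G)$ is a fixing set of $G$ if the only automorphism of $G$ fixing every element of $S$ is the identity; $\mathrm{Fix}(G)$ is the minimum size of a fixing set. $S(p,q)$: $q$ disjoint copies of the star $K_{1,p}$ whose $q$ centers are made pairwise adjacent. $S_2(p_1,q_1,\dots,p_m,q_m)$: for each $i$, $q_i$ disjoint copies of $K_{1,p_i}$, with all star centers (over all $i$) pairwise adjacent. $S_3(p,q_1,q_2)$: $q_1$ copies of $K_{1,p}$ and $q_2$ copies of $K_{1,p+1}$, all disjoint, with all centers pairwise adjacent, plus a vertex $e$ adjacent exactly to the centers of the $q_1$ copies of $K_{1,p}$. $S_4(p,q)$: the graph $S_3(p,2,q)$ plus a vertex $f$ adjacent to every vertex of $S_3(p,2,q)$ except $e$. -}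

module Defs where

open import Data.Nat using (ℕ; zero; suc; _+_; _*_; _∸_; _≤_)
open import Data.Fin using (Fin)
import Data.Fin as Fin
open import Data.List using (List; length)
open import Data.List.Membership.Propositional using (_∈_)
open import Data.List.Relation.Unary.Unique.Propositional using (Unique)
open import Data.Product using (Σ; _×_; _,_)
open import Function.Bundles using (_↔_; _⇔_; Inverse)
open import Relation.Binary.PropositionalEquality using (_≡_; _≢_)

-- A graph: a vertex type and an adjacency relation.  (All graphs built
-- below are finite and simple: symmetric, irreflexive adjacency.)
record Graph : Set₁ where
  field
    V : Set
    E : V → V → Set

open Graph public

record Aut (G : Graph) : Set where
  field
    perm     : V G ↔ V G
    preserve : ∀ u v → E G u v ⇔ E G (Inverse.to perm u) (Inverse.to perm v)

open Aut public

app : {G : Graph} → Aut G → V G → V G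
app σ v = Inverse.to (perm σ) v

IsFixingSet : (G : Graph) → List (V G) → Set
IsFixingSet G S =
  (σ : Aut G) → (∀ v → v ∈ S → app σ v ≡ v) → ∀ v → app σ v ≡ v

FixIs : Graph → ℕ → Set
FixIs G k =
  Σ (List (V G)) (λ S → Unique S × length S ≡ k × IsFixingSet G S)
  × (∀ (S : List (V G)) → Unique S → IsFixingSet G S → k ≤ length S)

f : ℕ → ℕ → ℕ
f (suc zero) q = q ∸ 1
f p          q = q * (p ∸ 1)

sumFin : (m : ℕ) → (Fin m → ℕ) → ℕ
sumFin zero    g = 0
sumFin (suc m) g = g Fin.zero + sumFin m (λ i → g (Fin.suc i))

-- S₂(p₁,q₁,…,pₘ,qₘ): for each i, q i copies of K_{1,p i};
-- all centers pairwise adjacent.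

data V₂ (m : ℕ) (p q : Fin m → ℕ) : Set where
  ctr  : (i : Fin m) → Fin (q i) → V₂ m p q
  leaf : (i : Fin m) → Fin (q i) → Fin (p i) → V₂ m p q

data E₂ {m : ℕ} {p q : Fin m → ℕ} : V₂ m p q → V₂ m p q → Set where
  cc : ∀ {i : Fin m} {j : Fin (q i)} {i' : Fin m} {j' : Fin (q i')} → _≢_ {A = V₂ m p q} (ctr i j) (ctr i' j') → E₂ (ctr i j) (ctr i' j')
  cl : ∀ {i : Fin m} {j : Fin (q i)} {k : Fin (p i)} → E₂ (ctr i j) (leaf i j k)
  lc : ∀ {i : Fin m} {j : Fin (q i)} {k : Fin (p i)} → E₂ (leaf i j k) (ctr i j)

S₂ : (m : ℕ) → (p q : Fin m → ℕ) → Graph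
S₂ m p q = record { V = V₂ m p q ; E = E₂ }

S : ℕ → ℕ → Graph
S p q = S₂ 1 (λ _ → p) (λ _ → q)

pair : ℕ → ℕ → Fin 2 → ℕ
pair a b Fin.zero       = a
pair a b (Fin.suc _)    = b

V₃base : ℕ → ℕ → ℕ → Set
V₃base p q₁ q₂ = V₂ 2 (pair p (suc p)) (pair q₁ q₂)

data V₃ (p q₁ q₂ : ℕ) : Set where
  base : V₃base p q₁ q₂ → V₃ p q₁ q₂
  e    : V₃ p q₁ q₂

data E₃ {p q₁ q₂ : ℕ} : V₃ p q₁ q₂ → V₃ p q₁ q₂ → Set where
  bb : ∀ {u v : V₃base p q₁ q₂} → E₂ u v → E₃ (base u) (base v)
  ec : ∀ {j : Fin q₁} → E₃ e (base (ctr Fin.zero j))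
  ce : ∀ {j : Fin q₁} → E₃ (base (ctr Fin.zero j)) e

S₃ : ℕ → ℕ → ℕ → Graph
S₃ p q₁ q₂ = record { V = V₃ p q₁ q₂ ; E = E₃ }

data V₄ (p q : ℕ) : Set where
  old : V₃ p 2 q → V₄ p q
  fv  : V₄ p q

data E₄ {p q : ℕ} : V₄ p q → V₄ p q → Set where
  oo : ∀ {u v : V₃ p 2 q} → E₃ u v → E₄ (old u) (old v)
  fo : ∀ {u : V₃base p 2 q} → E₄ fv (old (base u))
  of : ∀ {u : V₃base p 2 q} → E₄ (old (base u)) fv

S₄ : ℕ → ℕ → Graph
S₄ p q = record { V = V₄ p q ; E = E₄ }

{-# OPTIONS --safe #-}

-- Pin every leaf but the first of each star, except that in a block of single-leaf stars the
-- leaves of all stars but the first are pinned.  Swapping two leaves of a star, or two stars of a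
-- block, is an automorphism (extended to S₃ and S₄ by fixing e and f), so a fixing set contains
-- all but one leaf of every star and meets all but one star of a single-leaf block; this gives
-- the lower bound Σ f(pᵢ,qᵢ), the number of pinned leaves.  Conversely an automorphism fixing the
-- pinned leaves fixes every centre and then every leaf of S₂; in S₃ and S₄ it also fixes the apex
-- e resp. f, hence restricts to an automorphism of S₂ resp. S₃ fixing their pinned leaves.

module Submission where

open import Defs
open import Data.Empty using (⊥; ⊥-elim)
open import Data.Fin using (Fin; toℕ; fromℕ; fromℕ<)
import Data.Fin as Fin
import Data.Fin
import Data.Fin.Properties as Finₚ
open import Data.List using (List; []; _∷_; length; map; filter; concat; tabulate)
import Data.List.Properties as Listₚ
open import Data.List.Membership.Propositional using (_∈_)
import Data.List.Membership.Propositional.Properties as ∈ₚ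
import Data.List.Relation.Unary.All as All
import Data.List.Relation.Unary.All.Properties as Allₚ
open import Data.List.Relation.Unary.Any using (Any; here; there; index; _─_)
import Data.List.Relation.Unary.Any as Any
import Data.List.Relation.Unary.AllPairs.Properties as AllPairsₚ
open import Data.List.Relation.Unary.Unique.Propositional using (Unique; _∷_)
import Data.List.Relation.Unary.Unique.Propositional.Properties as Uniqueₚ
open import Data.Nat using (ℕ; zero; suc; _+_; _*_; _∸_; _≤_; _<_; z≤n; s≤s; _≤?_)
import Data.Nat as ℕ
import Data.Nat.Properties as ℕₚ
open import Data.Product using (Σ; ∃; _×_; _,_; proj₁; proj₂)
open import Data.Sum using (_⊎_; inj₁; inj₂; [_,_]′)
open import Function using (_∘_; id)
open import Function.Bundles using (_⇔_; Inverse; Equivalence; Injection; mk↔ₛ′; mk⇔)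
open import Function.Construct.Composition using (_⇔-∘_)
open import Function.Construct.Symmetry using (⇔-sym; ↔-sym)
open import Function.Properties.Inverse using (↔⇒↣)
open import Relation.Binary using (tri<; tri≈; tri>)
open import Relation.Binary.Definitions using (DecidableEquality)
open import Relation.Binary.PropositionalEquality
  using (_≡_; _≢_; refl; sym; trans; cong; cong₂; subst; subst₂)
open import Relation.Nullary using (¬_; yes; no)
open import Relation.Nullary.Decidable using (decidable-stable; _⊎-dec_; _×-dec_)
open import Relation.Unary using (Decidable)

Fixes : {G : Graph} → Aut G → List (V G) → Set
Fixes σ S = ∀ v → v ∈ S → app σ v ≡ v

FixingSetOfSize : Graph → ℕ → Set
FixingSetOfSize G k = Σ (List (V G)) λ S → Unique S × length S ≡ k × IsFixingSet G S

module _ {G : Graph} (σ : Aut G) where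

  app-injective : ∀ {x y} → app σ x ≡ app σ y → x ≡ y
  app-injective = Injection.injective (↔⇒↣ (perm σ))

  app-adjacent : ∀ {u v} → E G u v → E G (app σ u) (app σ v)
  app-adjacent {u} {v} = Equivalence.to (preserve σ u v)

  app-adjacent⁻ : ∀ {u v} → E G (app σ u) (app σ v) → E G u v
  app-adjacent⁻ {u} {v} = Equivalence.from (preserve σ u v)

  app-adjacentˡ : ∀ {a a′ v} → app σ a ≡ a′ → E G a v → E G a′ (app σ v)
  app-adjacentˡ σa≡a′ av = subst (λ t → E G t _) σa≡a′ (app-adjacent av)

  common-neighbour-fixed : ∀ {a b x} → app σ a ≡ a → app σ b ≡ b → E G a x → E G b x →
                           (∀ w → E G a w → E G b w → w ≡ x ⊎ app σ w ≡ w) → app σ x ≡ x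
  common-neighbour-fixed {x = x} σa≡a σb≡b ax bx others
    with others (app σ x) (app-adjacentˡ σa≡a ax) (app-adjacentˡ σb≡b bx)
  ... | inj₁ σx≡x   = σx≡x
  ... | inj₂ σσx≡σx = app-injective σσx≡σx

  unique-neighbour-fixed : ∀ {a x} → app σ a ≡ a → E G a x → (∀ w → E G a w → w ≡ x) → app σ x ≡ x
  unique-neighbour-fixed σa≡a ax unique =
    common-neighbour-fixed σa≡a σa≡a ax ax λ w aw _ → inj₁ (unique w aw)

  app-≢-pendant : ∀ {x a b z c} → E G x a → E G x b → a ≢ b → (∀ w → E G z w → w ≡ c) →
                  app σ x ≢ z
  app-≢-pendant xa xb a≢b z-pendant σx≡z = a≢b (app-injective
    (trans (z-pendant _ (app-adjacentˡ σx≡z xa)) (sym (z-pendant _ (app-adjacentˡ σx≡z xb)))))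

involution-aut : (G : Graph) (τ : V G → V G) → (∀ v → τ (τ v) ≡ v) →
                 (∀ {u v} → E G u v → E G (τ u) (τ v)) → Aut G
involution-aut G τ τ-involutive τ-adjacent = record
  { perm     = mk↔ₛ′ τ τ τ-involutive τ-involutive
  ; preserve = λ u v → mk⇔ τ-adjacent
      (λ τu-τv → subst₂ (E G) (τ-involutive u) (τ-involutive v) (τ-adjacent τu-τv))
  }

record OnePointExtension (H G : Graph) : Set where
  field
    ι           : V H → V G
    ι-injective : ∀ {u v} → ι u ≡ ι v → u ≡ v
    ι-adjacent  : ∀ u v → E H u v ⇔ E G (ι u) (ι v)
    apex        : V G
    ι≢apex      : ∀ u → ι u ≢ apex
    ι-or-apex   : ∀ w → (∃ λ u → ι u ≡ w) ⊎ w ≡ apex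

  restrict-map : (π : V G → V G) → (∀ {x y} → π x ≡ π y → x ≡ y) → π apex ≡ apex →
                 ∀ u → ∃ λ u′ → ι u′ ≡ π (ι u)
  restrict-map π π-injective π-apex u =
    [ id , (λ π-ιu≡apex → ⊥-elim (ι≢apex u (π-injective (trans π-ιu≡apex (sym π-apex))))) ]′
      (ι-or-apex (π (ι u)))

  restrict : (σ : Aut G) → app σ apex ≡ apex → Σ (Aut H) λ ρ → ∀ u → ι (app ρ u) ≡ app σ (ι u)
  restrict σ σ-apex = record { perm = mk↔ₛ′ ρ ρ⁻¹ ρ∘ρ⁻¹ ρ⁻¹∘ρ ; preserve = ρ-preserve } , ι-ρ
    where
    σ⁻¹ : V G → V G
    σ⁻¹ = Inverse.from (perm σ)

    σ⁻¹-injective : ∀ {x y} → σ⁻¹ x ≡ σ⁻¹ y → x ≡ y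
    σ⁻¹-injective = Injection.injective (↔⇒↣ (↔-sym (perm σ)))

    σ⁻¹-apex : σ⁻¹ apex ≡ apex
    σ⁻¹-apex = trans (cong σ⁻¹ (sym σ-apex)) (Inverse.strictlyInverseʳ (perm σ) apex)

    ρ ρ⁻¹ : V H → V H
    ρ   u = proj₁ (restrict-map (app σ) (app-injective σ) σ-apex u)
    ρ⁻¹ u = proj₁ (restrict-map σ⁻¹ σ⁻¹-injective σ⁻¹-apex u)

    ι-ρ : ∀ u → ι (ρ u) ≡ app σ (ι u)
    ι-ρ u = proj₂ (restrict-map (app σ) (app-injective σ) σ-apex u)

    ι-ρ⁻¹ : ∀ u → ι (ρ⁻¹ u) ≡ σ⁻¹ (ι u)
    ι-ρ⁻¹ u = proj₂ (restrict-map σ⁻¹ σ⁻¹-injective σ⁻¹-apex u)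

    ρ∘ρ⁻¹ : ∀ u → ρ (ρ⁻¹ u) ≡ u
    ρ∘ρ⁻¹ u = ι-injective (trans (ι-ρ (ρ⁻¹ u))
      (trans (cong (app σ) (ι-ρ⁻¹ u)) (Inverse.strictlyInverseˡ (perm σ) (ι u))))

    ρ⁻¹∘ρ : ∀ u → ρ⁻¹ (ρ u) ≡ u
    ρ⁻¹∘ρ u = ι-injective (trans (ι-ρ⁻¹ (ρ u))
      (trans (cong σ⁻¹ (ι-ρ u)) (Inverse.strictlyInverseʳ (perm σ) (ι u))))

    ρ-preserve : ∀ u v → E H u v ⇔ E H (ρ u) (ρ v)
    ρ-preserve u v = ⇔-sym (ι-adjacent (ρ u) (ρ v)) ⇔-∘
      (subst₂ (λ x y → E G (ι u) (ι v) ⇔ E G x y) (sym (ι-ρ u)) (sym (ι-ρ v)) (preserve σ (ι u) (ι v))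
        ⇔-∘ ι-adjacent u v)

  extend-fixingSet : ∀ {S} → IsFixingSet H S →
                     (∀ σ → Fixes σ (map ι S) → app σ apex ≡ apex) → IsFixingSet G (map ι S)
  extend-fixingSet {S} S-fixing apex-fixed σ σ-fixes w with restrict σ (apex-fixed σ σ-fixes)
  ... | ρ , ι-ρ = [ (λ { (u , refl) → trans (sym (ι-ρ u)) (cong ι (ρ-identity u)) })
                  , (λ { refl → apex-fixed σ σ-fixes }) ]′ (ι-or-apex w)
    where
    ρ-identity : ∀ u → app ρ u ≡ u
    ρ-identity = S-fixing ρ λ u u∈S →
      ι-injective (trans (ι-ρ u) (σ-fixes (ι u) (∈ₚ.∈-map⁺ ι u∈S)))

  extend-fixingSetOfSize : ∀ {k} → ((S , _) : FixingSetOfSize H k) →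
                           (∀ σ → Fixes σ (map ι S) → app σ apex ≡ apex) → FixingSetOfSize G k
  extend-fixingSetOfSize (S , S-unique , |S|≡k , S-fixing) apex-fixed =
    map ι S , Uniqueₚ.map⁺ ι-injective S-unique , trans (Listₚ.length-map ι S) |S|≡k ,
    extend-fixingSet S-fixing apex-fixed

count : {A : Set} {P : A → Set} → Decidable P → List A → ℕ
count P? xs = length (filter P? xs)

module _ {A : Set} where

  ∈-─ : ∀ {x y : A} {ys} (x∈ys : x ∈ ys) → y ∈ ys → y ≢ x → y ∈ (ys ─ x∈ys)
  ∈-─ (here refl)  (here refl)  y≢x = ⊥-elim (y≢x refl)
  ∈-─ (here refl)  (there y∈ys) _   = y∈ys
  ∈-─ (there x∈ys) (here refl)  _   = here refl
  ∈-─ (there x∈ys) (there y∈ys) y≢x = there (∈-─ x∈ys y∈ys y≢x)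

  Unique-⊆⇒length≤ : ∀ {xs ys : List A} → Unique xs → (∀ {x} → x ∈ xs → x ∈ ys) →
                     length xs ≤ length ys
  Unique-⊆⇒length≤ {[]}          _                   _     = z≤n
  Unique-⊆⇒length≤ {x ∷ xs} {ys} (x∉xs ∷ xs-unique) xs⊆ys =
    subst (suc (length xs) ≤_) (sym (Listₚ.length-removeAt′ ys (index x∈ys)))
      (s≤s (Unique-⊆⇒length≤ xs-unique λ y∈xs →
        ∈-─ x∈ys (xs⊆ys (there y∈xs)) (λ y≡x → All.lookup x∉xs y∈xs (sym y≡x))))
    where
    x∈ys : x ∈ ys
    x∈ys = xs⊆ys (here refl)

  Unique-concat-tabulate : ∀ {n} (g : Fin n → List A) → (∀ k → Unique (g k)) →
                           (∀ {k k′ x} → x ∈ g k → x ∈ g k′ → k ≡ k′) → Unique (concat (tabulate g))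
  Unique-concat-tabulate g g-unique g-disjoint = Uniqueₚ.concat⁺ (Allₚ.tabulate⁺ g-unique)
    (AllPairsₚ.tabulate⁺ λ k≢k′ (x∈gk , x∈gk′) → k≢k′ (g-disjoint x∈gk x∈gk′))

  module _ {P : A → Set} (P? : Decidable P) where

    count-cons-≤ : ∀ x xs → count P? xs ≤ count P? (x ∷ xs)
    count-cons-≤ x xs with P? x
    ... | yes _ = ℕₚ.n≤1+n _
    ... | no  _ = ℕₚ.≤-refl

    count-concat-tabulate : ∀ {n} (g : Fin n → List A) →
                            count P? (concat (tabulate g)) ≡ sumFin n (count P? ∘ g)
    count-concat-tabulate {zero}  g = refl
    count-concat-tabulate {suc n} g = trans
      (cong length (Listₚ.filter-++ P? (g Fin.zero) (concat (tabulate (g ∘ Fin.suc)))))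
      (trans (Listₚ.length-++ (filter P? (g Fin.zero)))
        (cong (count P? (g Fin.zero) +_) (count-concat-tabulate (g ∘ Fin.suc))))

    count-tabulate-all : ∀ {n} (g : Fin n → A) → (∀ k → P (g k)) → count P? (tabulate g) ≡ n
    count-tabulate-all g all =
      trans (cong length (Listₚ.filter-all P? (Allₚ.tabulate⁺ all))) (Listₚ.length-tabulate g)

    count-tabulate-all-but-first : ∀ {n} (g : Fin n → A) → (∀ {k} → toℕ k ≡ 0 → ¬ P (g k)) →
                                   (∀ {k} → 1 ≤ toℕ k → P (g k)) → count P? (tabulate g) ≡ n ∸ 1
    count-tabulate-all-but-first {zero}  g first rest = refl
    count-tabulate-all-but-first {suc n} g first rest =
      trans (cong length (Listₚ.filter-reject P? (first refl)))
        (count-tabulate-all (g ∘ Fin.suc) λ _ → rest (s≤s z≤n))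

    count-tabulate-all-but-one : ∀ {n} (g : Fin n → A) →
                                 (∀ {k k′} → ¬ P (g k) → ¬ P (g k′) → k ≡ k′) →
                                 n ≤ suc (count P? (tabulate g))
    count-tabulate-all-but-one {zero}  g at-most-one = z≤n
    count-tabulate-all-but-one {suc n} g at-most-one with P? (g Fin.zero)
    ... | yes _   = s≤s (count-tabulate-all-but-one (g ∘ Fin.suc)
                      λ ¬Pk ¬Pk′ → Finₚ.suc-injective (at-most-one ¬Pk ¬Pk′))
    ... | no ¬P₀ = s≤s (ℕₚ.≤-reflexive (sym (count-tabulate-all (g ∘ Fin.suc) λ k →
                      decidable-stable (P? _) λ ¬Pk → Finₚ.0≢1+n (at-most-one ¬P₀ ¬Pk))))

    count-tabulate≤sumFin : ∀ {n} (g : Fin n → A) (c : Fin n → ℕ) → (∀ k → P (g k) → 1 ≤ c k) →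
                            count P? (tabulate g) ≤ sumFin n c
    count-tabulate≤sumFin {zero}  g c P⇒1≤c = z≤n
    count-tabulate≤sumFin {suc n} g c P⇒1≤c
      with P? (g Fin.zero) | count-tabulate≤sumFin (g ∘ Fin.suc) (c ∘ Fin.suc) (P⇒1≤c ∘ Fin.suc)
    ... | yes P₀ | rest = ℕₚ.+-mono-≤ (P⇒1≤c Fin.zero P₀) rest
    ... | no  _  | rest = ℕₚ.≤-trans rest (ℕₚ.m≤n+m _ (c Fin.zero))

sumFin-cong : ∀ {n} {g h : Fin n → ℕ} → (∀ k → g k ≡ h k) → sumFin n g ≡ sumFin n h
sumFin-cong {zero}  g≡h = refl
sumFin-cong {suc n} g≡h = cong₂ _+_ (g≡h Fin.zero) (sumFin-cong (g≡h ∘ Fin.suc))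

sumFin-mono : ∀ {n} {g h : Fin n → ℕ} → (∀ k → g k ≤ h k) → sumFin n g ≤ sumFin n h
sumFin-mono {zero}  g≤h = z≤n
sumFin-mono {suc n} g≤h = ℕₚ.+-mono-≤ (g≤h Fin.zero) (sumFin-mono (g≤h ∘ Fin.suc))

sumFin-const : ∀ {n} {g : Fin n → ℕ} {c} → (∀ k → g k ≡ c) → sumFin n g ≡ n * c
sumFin-const {zero}  g≡c = refl
sumFin-const {suc n} g≡c = cong₂ _+_ (g≡c Fin.zero) (sumFin-const (g≡c ∘ Fin.suc))

sumFin-all-but-first : ∀ {n} {g : Fin n → ℕ} → (∀ {k} → toℕ k ≡ 0 → g k ≡ 0) →
                       (∀ {k} → 1 ≤ toℕ k → g k ≡ 1) → sumFin n g ≡ n ∸ 1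
sumFin-all-but-first {zero}  first rest = refl
sumFin-all-but-first {suc n} first rest =
  trans (cong₂ _+_ (first refl) (sumFin-const {n} λ _ → rest (s≤s z≤n))) (ℕₚ.*-identityʳ n)

f-≥2 : ∀ {p} q → 2 ≤ p → f p q ≡ q * (p ∸ 1)
f-≥2 {suc (suc p)} q _         = refl
f-≥2 {suc zero}    q (s≤s ())

module _ {n : ℕ} where

  swap : Fin n → Fin n → Fin n → Fin n
  swap i j k with k Fin.≟ i
  ... | yes _ = j
  ... | no  _ with k Fin.≟ j
  ...   | yes _ = i
  ...   | no  _ = k

  swap-matchˡ : ∀ i j → swap i j i ≡ j
  swap-matchˡ i j with i Fin.≟ i
  ... | yes _   = refl
  ... | no  i≢i = ⊥-elim (i≢i refl)

  swap-matchʳ : ∀ i j → swap i j j ≡ i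
  swap-matchʳ i j with j Fin.≟ i
  ... | yes refl = refl
  ... | no  _ with j Fin.≟ j
  ...   | yes _   = refl
  ...   | no  j≢j = ⊥-elim (j≢j refl)

  swap-support : ∀ i j k → swap i j k ≡ k ⊎ (k ≡ i ⊎ k ≡ j)
  swap-support i j k with k Fin.≟ i
  ... | yes k≡i = inj₂ (inj₁ k≡i)
  ... | no  k≢i with k Fin.≟ j
  ...   | yes k≡j = inj₂ (inj₂ k≡j)
  ...   | no  _   = inj₁ refl

  swap-involutive : ∀ i j k → swap i j (swap i j k) ≡ k
  swap-involutive i j k with swap-support i j k
  ... | inj₁ swap≡k      = trans (cong (swap i j) swap≡k) swap≡k
  ... | inj₂ (inj₁ refl) = trans (cong (swap k j) (swap-matchˡ k j)) (swap-matchʳ k j)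
  ... | inj₂ (inj₂ refl) = trans (cong (swap i k) (swap-matchʳ i k)) (swap-matchˡ i k)

module S₂-Properties {m : ℕ} (p q : Fin m → ℕ) where

  Vertex : Set
  Vertex = V₂ m p q

  _≟_ : DecidableEquality Vertex
  ctr i j ≟ ctr i′ j′ with i Fin.≟ i′
  ... | no  i≢i′ = no λ { refl → i≢i′ refl }
  ... | yes refl with j Fin.≟ j′
  ...   | no  j≢j′ = no λ { refl → j≢j′ refl }
  ...   | yes refl = yes refl
  ctr _ _    ≟ leaf _ _ _ = no λ ()
  leaf _ _ _ ≟ ctr _ _    = no λ ()
  leaf i j k ≟ leaf i′ j′ k′ with i Fin.≟ i′
  ... | no  i≢i′ = no λ { refl → i≢i′ refl }
  ... | yes refl with j Fin.≟ j′
  ...   | no  j≢j′ = no λ { refl → j≢j′ refl }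
  ...   | yes refl with k Fin.≟ k′
  ...     | no  k≢k′ = no λ { refl → k≢k′ refl }
  ...     | yes refl = yes refl

  ctr-injective : ∀ {i j j′} → _≡_ {A = Vertex} (ctr i j) (ctr i j′) → j ≡ j′
  ctr-injective refl = refl

  leaf-injective : ∀ {i j k k′} → _≡_ {A = Vertex} (leaf i j k) (leaf i j k′) → k ≡ k′
  leaf-injective refl = refl

  star : (i : Fin m) → Fin (q i) → List Vertex
  star i j = ctr i j ∷ tabulate (leaf i j)

  block : Fin m → List Vertex
  block i = concat (tabulate (star i))

  vertices : List Vertex
  vertices = concat (tabulate block)

  starOf : Vertex → Σ (Fin m) (Fin ∘ q)
  starOf (ctr  i j)   = i , j
  starOf (leaf i j _) = i , j

  ∈-star⇒starOf : ∀ {i j v} → v ∈ star i j → starOf v ≡ (i , j)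
  ∈-star⇒starOf (here refl)      = refl
  ∈-star⇒starOf {i} {j} (there v∈leaves) with ∈ₚ.∈-tabulate⁻ {f = leaf i j} v∈leaves
  ... | _ , refl = refl

  ∈-star-injective : ∀ {i j j′ v} → v ∈ star i j → v ∈ star i j′ → j ≡ j′
  ∈-star-injective v∈star v∈star′ with trans (sym (∈-star⇒starOf v∈star)) (∈-star⇒starOf v∈star′)
  ... | refl = refl

  ∈-block⇒blockOf : ∀ {i v} → v ∈ block i → proj₁ (starOf v) ≡ i
  ∈-block⇒blockOf {i} v∈block with ∈ₚ.∈-concat⁻′ (tabulate (star i)) v∈block
  ... | _ , v∈star , star∈stars with ∈ₚ.∈-tabulate⁻ star∈stars
  ...   | _ , refl = cong proj₁ (∈-star⇒starOf v∈star)

  ctr∉leaves : ∀ {i j} {v : Vertex} → v ∈ tabulate (leaf i j) → ctr i j ≢ v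
  ctr∉leaves {i} {j} v∈leaves with ∈ₚ.∈-tabulate⁻ {f = leaf i j} v∈leaves
  ... | _ , refl = λ ()

  vertices-unique : Unique vertices
  vertices-unique = Unique-concat-tabulate block block-unique λ v∈block v∈block′ →
    trans (sym (∈-block⇒blockOf v∈block)) (∈-block⇒blockOf v∈block′)
    where
    star-unique : ∀ i j → Unique (star i j)
    star-unique i j = All.tabulate ctr∉leaves ∷ Uniqueₚ.tabulate⁺ leaf-injective

    block-unique : ∀ i → Unique (block i)
    block-unique i = Unique-concat-tabulate (star i) (star-unique i) ∈-star-injective

  star⊆vertices : ∀ {i j v} → v ∈ star i j → v ∈ vertices
  star⊆vertices {i} {j} v∈star =
    ∈ₚ.∈-concat⁺′ (∈ₚ.∈-concat⁺′ v∈star (∈ₚ.∈-tabulate⁺ j)) (∈ₚ.∈-tabulate⁺ i)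

  ∈-vertices : ∀ v → v ∈ vertices
  ∈-vertices (ctr  i j)   = star⊆vertices (here refl)
  ∈-vertices (leaf i j k) = star⊆vertices (there (∈ₚ.∈-tabulate⁺ k))

  count-vertices : ∀ {P : Vertex → Set} (P? : Decidable P) →
                   count P? vertices ≡ sumFin m λ i → sumFin (q i) λ j → count P? (star i j)
  count-vertices P? =
    trans (count-concat-tabulate P? block) (sumFin-cong λ i → count-concat-tabulate P? (star i))

  Pinned : Vertex → Set
  Pinned (ctr _ _)    = ⊥
  Pinned (leaf i j k) = 1 ≤ toℕ k ⊎ (p i ≡ 1 × 1 ≤ toℕ j)

  Pinned? : Decidable Pinned
  Pinned? (ctr _ _)    = no λ ()
  Pinned? (leaf i j k) = 1 ≤? toℕ k ⊎-dec (p i ℕ.≟ 1 ×-dec 1 ≤? toℕ j)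

  pinned : List Vertex
  pinned = filter Pinned? vertices

  ∈-pinned : ∀ {v} → Pinned v → v ∈ pinned
  ∈-pinned {v} = ∈ₚ.∈-filter⁺ Pinned? (∈-vertices v)

  count-pinned-star-all : ∀ {i j} → p i ≡ 1 × 1 ≤ toℕ j → count Pinned? (star i j) ≡ p i
  count-pinned-star-all {i} {j} p≡1∧1≤j = count-tabulate-all Pinned? (leaf i j) λ _ → inj₂ p≡1∧1≤j

  count-pinned-star-all-but-first : ∀ {i j} → ¬ (p i ≡ 1 × 1 ≤ toℕ j) →
                                    count Pinned? (star i j) ≡ p i ∸ 1
  count-pinned-star-all-but-first {i} {j} ¬p≡1∧1≤j = count-tabulate-all-but-first Pinned? (leaf i j)
    (λ k≡0 → [ (λ 1≤k → ℕₚ.n≮0 (subst (1 ≤_) k≡0 1≤k)) , ¬p≡1∧1≤j ]′) inj₁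

  count-pinned-block : ∀ i → 1 ≤ p i → sumFin (q i) (λ j → count Pinned? (star i j)) ≡ f (p i) (q i)
  count-pinned-block i 1≤p with ℕₚ.m≤n⇒m<n∨m≡n 1≤p
  ... | inj₁ 2≤p = trans
    (sumFin-const {q i} λ _ → count-pinned-star-all-but-first λ (p≡1 , _) → ℕₚ.<⇒≢ 2≤p (sym p≡1))
    (sym (f-≥2 (q i) 2≤p))
  ... | inj₂ 1≡p = trans
    (sumFin-all-but-first {q i}
      (λ j≡0 → trans (count-pinned-star-all-but-first λ (_ , 1≤j) → ℕₚ.n≮0 (subst (1 ≤_) j≡0 1≤j))
                     (cong (_∸ 1) (sym 1≡p)))
      (λ 1≤j → trans (count-pinned-star-all (sym 1≡p , 1≤j)) (sym 1≡p)))
    (cong (λ t → f t (q i)) 1≡p)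

  pinned-length : (∀ i → 1 ≤ p i) → length pinned ≡ sumFin m λ i → f (p i) (q i)
  pinned-length p≥1 = trans (count-vertices Pinned?) (sumFin-cong λ i → count-pinned-block i (p≥1 i))

  record BlockSymmetry : Set where
    field
      τ            : Vertex → Vertex
      τ-involutive : ∀ v → τ (τ v) ≡ v
      τ-adjacent   : ∀ {u v} → E₂ u v → E₂ (τ u) (τ v)
      τ-ctr        : ∀ i j → ∃ λ j′ → τ (ctr i j) ≡ ctr i j′

  module LeafSwap (i : Fin m) (j : Fin (q i)) (k k′ : Fin (p i)) where

    τ : Vertex → Vertex
    τ (ctr a b) = ctr a b
    τ (leaf a b c) with ctr a b ≟ ctr i j
    ... | yes refl = leaf i j (swap k k′ c)
    ... | no  _    = leaf a b c

    τ-other-star : ∀ {a b c} → ctr a b ≢ ctr i j → τ (leaf a b c) ≡ leaf a b c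
    τ-other-star {a} {b} ≢ctr with ctr a b ≟ ctr i j
    ... | yes ≡ctr = ⊥-elim (≢ctr ≡ctr)
    ... | no  _    = refl

    τ-involutive : ∀ v → τ (τ v) ≡ v
    τ-involutive (ctr a b) = refl
    τ-involutive (leaf a b c) with ctr a b ≟ ctr i j
    ... | no  ≢ctr = τ-other-star ≢ctr
    ... | yes refl with ctr i j ≟ ctr i j
    ...   | yes refl = cong (leaf i j) (swap-involutive k k′ c)
    ...   | no  ≢ctr = ⊥-elim (≢ctr refl)

    τ-adjacent : ∀ {u v} → E₂ u v → E₂ (τ u) (τ v)
    τ-adjacent (cc ≢ctr) = cc ≢ctr
    τ-adjacent (cl {i = a} {j = b}) with ctr a b ≟ ctr i j
    ... | yes refl = cl
    ... | no  _    = cl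
    τ-adjacent (lc {i = a} {j = b}) with ctr a b ≟ ctr i j
    ... | yes refl = lc
    ... | no  _    = lc

    τ-support : ∀ v → τ v ≡ v ⊎ (v ≡ leaf i j k ⊎ v ≡ leaf i j k′)
    τ-support (ctr a b) = inj₁ refl
    τ-support (leaf a b c) with ctr a b ≟ ctr i j
    ... | no  _    = inj₁ refl
    ... | yes refl with swap-support k k′ c
    ...   | inj₁ swap≡c      = inj₁ (cong (leaf i j) swap≡c)
    ...   | inj₂ (inj₁ refl) = inj₂ (inj₁ refl)
    ...   | inj₂ (inj₂ refl) = inj₂ (inj₂ refl)

    τ-moves : τ (leaf i j k) ≡ leaf i j k′
    τ-moves with ctr i j ≟ ctr i j
    ... | yes refl = cong (leaf i j) (swap-matchˡ k k′)
    ... | no  ≢ctr = ⊥-elim (≢ctr refl)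

    leafSwap : BlockSymmetry
    leafSwap = record
      { τ = τ ; τ-involutive = τ-involutive ; τ-adjacent = τ-adjacent ; τ-ctr = λ _ b → b , refl }

  module StarSwap (i : Fin m) (j j′ : Fin (q i)) where

    π : (a : Fin m) → Fin (q a) → Fin (q a)
    π a b with a Fin.≟ i
    ... | yes refl = swap j j′ b
    ... | no  _    = b

    π-involutive : ∀ a b → π a (π a b) ≡ b
    π-involutive a b with a Fin.≟ i
    ... | no  _    = refl
    ... | yes refl with i Fin.≟ i
    ...   | yes refl = swap-involutive j j′ b
    ...   | no  i≢i  = ⊥-elim (i≢i refl)

    τ : Vertex → Vertex
    τ (ctr  a b)   = ctr  a (π a b)
    τ (leaf a b c) = leaf a (π a b) c

    τ-involutive : ∀ v → τ (τ v) ≡ v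
    τ-involutive (ctr  a b)   = cong (ctr a) (π-involutive a b)
    τ-involutive (leaf a b c) = cong (λ b′ → leaf a b′ c) (π-involutive a b)

    τ-injective : ∀ {u v} → τ u ≡ τ v → u ≡ v
    τ-injective {u} {v} τu≡τv = trans (sym (τ-involutive u)) (trans (cong τ τu≡τv) (τ-involutive v))

    τ-adjacent : ∀ {u v} → E₂ u v → E₂ (τ u) (τ v)
    τ-adjacent (cc ≢ctr) = cc (≢ctr ∘ τ-injective)
    τ-adjacent cl        = cl
    τ-adjacent lc        = lc

    τ-support : ∀ v → τ v ≡ v ⊎ (v ∈ star i j ⊎ v ∈ star i j′)
    τ-support (ctr a b) with a Fin.≟ i
    ... | no  _    = inj₁ refl
    ... | yes refl with swap-support j j′ b
    ...   | inj₁ swap≡b      = inj₁ (cong (ctr i) swap≡b)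
    ...   | inj₂ (inj₁ refl) = inj₂ (inj₁ (here refl))
    ...   | inj₂ (inj₂ refl) = inj₂ (inj₂ (here refl))
    τ-support (leaf a b c) with a Fin.≟ i
    ... | no  _    = inj₁ refl
    ... | yes refl with swap-support j j′ b
    ...   | inj₁ swap≡b      = inj₁ (cong (λ b′ → leaf i b′ c) swap≡b)
    ...   | inj₂ (inj₁ refl) = inj₂ (inj₁ (there (∈ₚ.∈-tabulate⁺ c)))
    ...   | inj₂ (inj₂ refl) = inj₂ (inj₂ (there (∈ₚ.∈-tabulate⁺ c)))

    τ-moves : τ (ctr i j) ≡ ctr i j′
    τ-moves with i Fin.≟ i
    ... | yes refl = cong (ctr i) (swap-matchˡ j j′)
    ... | no  i≢i  = ⊥-elim (i≢i refl)

    starSwap : BlockSymmetry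
    starSwap = record
      { τ = τ ; τ-involutive = τ-involutive ; τ-adjacent = τ-adjacent ; τ-ctr = λ a b → π a b , refl }

  open LeafSwap using (leafSwap)
  open StarSwap using (starSwap)

  record SymmetricEmbedding (G : Graph) : Set where
    field
      ι            : Vertex → V G
      ι-injective  : ∀ {u v} → ι u ≡ ι v → u ≡ v
      _≟G_         : DecidableEquality (V G)
      lift         : BlockSymmetry → Aut G
      lift-ι       : ∀ s u → app (lift s) (ι u) ≡ ι (BlockSymmetry.τ s u)
      lift-outside : ∀ s w → (∃ λ u → ι u ≡ w) ⊎ app (lift s) w ≡ w

  module _ {P : Vertex → Set} (P? : Decidable P)
           (leaves-rigid : ∀ {i j k k′} → ¬ P (leaf i j k) → ¬ P (leaf i j k′) → k ≡ k′)
           (stars-rigid : ∀ {i j j′} → ¬ Any P (star i j) → ¬ Any P (star i j′) → j ≡ j′) where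

    count-star-≥ : ∀ i j → p i ∸ 1 ≤ count P? (star i j)
    count-star-≥ i j = ℕₚ.≤-trans
      (ℕₚ.∸-monoˡ-≤ 1 (count-tabulate-all-but-one P? (leaf i j) leaves-rigid))
      (count-cons-≤ P? (ctr i j) _)

    count-block-≥ : ∀ i → q i ∸ 1 ≤ sumFin (q i) λ j → count P? (star i j)
    count-block-≥ i = ℕₚ.≤-trans
      (ℕₚ.∸-monoˡ-≤ 1 (count-tabulate-all-but-one (Any.any? P? ∘ star i) id stars-rigid))
      (count-tabulate≤sumFin (Any.any? P? ∘ star i) id _ λ j → Listₚ.filter-some P?)

    f≤count-block : ∀ i → 1 ≤ p i → f (p i) (q i) ≤ sumFin (q i) λ j → count P? (star i j)
    f≤count-block i 1≤p with ℕₚ.m≤n⇒m<n∨m≡n 1≤p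
    ... | inj₁ 2≤p = begin
      f (p i) (q i)                 ≡⟨ f-≥2 (q i) 2≤p ⟩
      q i * (p i ∸ 1)               ≡⟨ sym (sumFin-const {q i} λ _ → refl) ⟩
      sumFin (q i) (λ _ → p i ∸ 1)  ≤⟨ sumFin-mono (count-star-≥ i) ⟩
      sumFin (q i) (λ j → count P? (star i j)) ∎
      where open ℕₚ.≤-Reasoning
    ... | inj₂ 1≡p = subst (λ p′ → f p′ (q i) ≤ sumFin (q i) λ j → count P? (star i j)) 1≡p
                       (count-block-≥ i)

    sum-f≤count : (∀ i → 1 ≤ p i) → sumFin m (λ i → f (p i) (q i)) ≤ count P? vertices
    sum-f≤count p≥1 = ℕₚ.≤-trans (sumFin-mono λ i → f≤count-block i (p≥1 i))
                                 (ℕₚ.≤-reflexive (sym (count-vertices P?)))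

  module _ {G : Graph} (X : SymmetricEmbedding G) (S : List (V G)) where
    open SymmetricEmbedding X
    open BlockSymmetry

    Hit : Vertex → Set
    Hit u = ι u ∈ S

    Hit? : Decidable Hit
    Hit? u = Any.any? (ι u ≟G_) S

    count-hits≤length : count Hit? vertices ≤ length S
    count-hits≤length = begin
      count Hit? vertices                   ≡⟨ sym (Listₚ.length-map ι (filter Hit? vertices)) ⟩
      length (map ι (filter Hit? vertices)) ≤⟨ Unique-⊆⇒length≤ hits-unique hits⊆S ⟩
      length S                              ∎
      where
      open ℕₚ.≤-Reasoning
      hits-unique : Unique (map ι (filter Hit? vertices))
      hits-unique = Uniqueₚ.map⁺ ι-injective (Uniqueₚ.filter⁺ Hit? vertices-unique)
      hits⊆S : ∀ {w} → w ∈ map ι (filter Hit? vertices) → w ∈ S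
      hits⊆S w∈hits with ∈ₚ.∈-map⁻ ι w∈hits
      ... | u , u∈hits , refl = proj₂ (∈ₚ.∈-filter⁻ Hit? {xs = vertices} u∈hits)

    module _ (S-fixing : IsFixingSet G S) where

      symmetry-fixing-hits-trivial : (s : BlockSymmetry) → (∀ u → Hit u → τ s u ≡ u) → ∀ u → τ s u ≡ u
      symmetry-fixing-hits-trivial s fixes-hits u =
        ι-injective (trans (sym (lift-ι s u)) (S-fixing (lift s) lift-fixes-S (ι u)))
        where
        lift-fixes-S : Fixes (lift s) S
        lift-fixes-S w w∈S with lift-outside s w
        ... | inj₁ (u , refl) = trans (lift-ι s u) (cong ι (fixes-hits u w∈S))
        ... | inj₂ fixed      = fixed

      unhit-leaves-equal : ∀ {i j k k′} → ¬ Hit (leaf i j k) → ¬ Hit (leaf i j k′) → k ≡ k′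
      unhit-leaves-equal {i} {j} {k} {k′} ¬hit ¬hit′ = leaf-injective (trans
        (sym (symmetry-fixing-hits-trivial (leafSwap i j k k′) fixes-hits (leaf i j k)))
        (LeafSwap.τ-moves i j k k′))
        where
        fixes-hits : ∀ u → Hit u → LeafSwap.τ i j k k′ u ≡ u
        fixes-hits u hit with LeafSwap.τ-support i j k k′ u
        ... | inj₁ fixed       = fixed
        ... | inj₂ (inj₁ refl) = ⊥-elim (¬hit hit)
        ... | inj₂ (inj₂ refl) = ⊥-elim (¬hit′ hit)

      unhit-stars-equal : ∀ {i j j′} → ¬ Any Hit (star i j) → ¬ Any Hit (star i j′) → j ≡ j′
      unhit-stars-equal {i} {j} {j′} ¬hit ¬hit′ = ctr-injective (trans
        (sym (symmetry-fixing-hits-trivial (starSwap i j j′) fixes-hits (ctr i j)))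
        (StarSwap.τ-moves i j j′))
        where
        fixes-hits : ∀ u → Hit u → StarSwap.τ i j j′ u ≡ u
        fixes-hits u hit with StarSwap.τ-support i j j′ u
        ... | inj₁ fixed         = fixed
        ... | inj₂ (inj₁ u∈star) = ⊥-elim (¬hit (Any.map (λ u≡ → subst Hit u≡ hit) u∈star))
        ... | inj₂ (inj₂ u∈star) = ⊥-elim (¬hit′ (Any.map (λ u≡ → subst Hit u≡ hit) u∈star))

  lower-bound : ∀ {G} → SymmetricEmbedding G → (∀ i → 1 ≤ p i) →
                ∀ S → IsFixingSet G S → sumFin m (λ i → f (p i) (q i)) ≤ length S
  lower-bound X p≥1 S S-fixing = ℕₚ.≤-trans
    (sum-f≤count (Hit? X S) (unhit-leaves-equal X S S-fixing) (unhit-stars-equal X S S-fixing) p≥1)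
    (count-hits≤length X S)

  pinned-leaf-or-first-single-leaf : ∀ i j → 1 ≤ p i → (∃ λ k → Pinned (leaf i j k)) ⊎ (p i ≡ 1 × toℕ j ≡ 0)
  pinned-leaf-or-first-single-leaf i j 1≤p with 2 ≤? p i
  ... | yes 2≤p = inj₁ (fromℕ< 2≤p , inj₁ (ℕₚ.≤-reflexive (sym (Finₚ.toℕ-fromℕ< 2≤p))))
  ... | no  2≰p = single-leaf-block (ℕₚ.≤-antisym (ℕₚ.≤-pred (ℕₚ.≰⇒> 2≰p)) 1≤p)
    where
    single-leaf-block : p i ≡ 1 → (∃ λ k → Pinned (leaf i j k)) ⊎ (p i ≡ 1 × toℕ j ≡ 0)
    single-leaf-block p≡1 with toℕ j
    ... | zero  = inj₂ (p≡1 , refl)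
    ... | suc _ = inj₁ (fromℕ< 1≤p , inj₂ (p≡1 , s≤s z≤n))

  unpinned-leaves-equal : ∀ {i j k k′} → ¬ Pinned (leaf i j k) → ¬ Pinned (leaf i j k′) → k ≡ k′
  unpinned-leaves-equal ¬pinned ¬pinned′ =
    Finₚ.toℕ-injective (trans (index≡0 ¬pinned) (sym (index≡0 ¬pinned′)))
    where
    index≡0 : ∀ {i j k} → ¬ Pinned (leaf i j k) → toℕ k ≡ 0
    index≡0 ¬pinned = ℕₚ.n<1⇒n≡0 (ℕₚ.≰⇒> (¬pinned ∘ inj₁))

  AtMostOneSingleLeafBlock : Set
  AtMostOneSingleLeafBlock = ∀ {i i′} → p i ≡ 1 → p i′ ≡ 1 → i ≡ i′

  EveryCentreHasAnother : Set
  EveryCentreHasAnother =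
    ∀ i j → Σ (Fin m) λ i′ → Σ (Fin (q i′)) λ j′ → _≢_ {A = Vertex} (ctr i j) (ctr i′ j′)

  S₂-embedding : SymmetricEmbedding (S₂ m p q)
  S₂-embedding = record
    { ι = id ; ι-injective = id ; _≟G_ = _≟_
    ; lift = λ s → involution-aut (S₂ m p q) (τ s) (τ-involutive s) (τ-adjacent s)
    ; lift-ι = λ _ _ → refl ; lift-outside = λ _ w → inj₁ (w , refl) }
    where open BlockSymmetry

  module _ (p≥1 : ∀ i → 1 ≤ p i) (single-leaf-block-unique : AtMostOneSingleLeafBlock)
           (another-ctr : EveryCentreHasAnother) where

    module PinnedFixing (σ : Aut (S₂ m p q)) (σ-pinned : Fixes σ pinned) where
      pinned-fixed : ∀ {v} → Pinned v → app σ v ≡ v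
      pinned-fixed {v} pinned-v = σ-pinned v (∈-pinned pinned-v)

      ctr-fixed-by-leaf : ∀ {i j k} → Pinned (leaf i j k) → app σ (ctr i j) ≡ ctr i j
      ctr-fixed-by-leaf pinned-k = unique-neighbour-fixed σ (pinned-fixed pinned-k) lc λ { _ lc → refl }

      -- Only the first star of the single-leaf block lacks a pinned leaf; its centre has two
      -- neighbours, so σ maps it to a centre, and all other centres are already fixed.
      ctr-fixed : ∀ i j → app σ (ctr i j) ≡ ctr i j
      ctr-fixed i j with pinned-leaf-or-first-single-leaf i j (p≥1 i)
      ... | inj₁ (_ , pinned-k) = ctr-fixed-by-leaf pinned-k
      ... | inj₂ (p≡1 , j≡0) with app σ (ctr i j) in σc≡ | another-ctr i j
      ...   | leaf a b c | i′ , j′ , ≢ctr = ⊥-elim (app-≢-pendant σ (cl {k = fromℕ< (p≥1 i)}) (cc ≢ctr)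
                                              (λ ()) (λ { _ lc → refl }) σc≡)
      ...   | ctr a b    | _ with pinned-leaf-or-first-single-leaf a b (p≥1 a)
      ...     | inj₁ (_ , pinned-k) = sym (app-injective σ (trans σc≡ (sym (ctr-fixed-by-leaf pinned-k))))
      ...     | inj₂ (p′≡1 , b≡0) with single-leaf-block-unique p′≡1 p≡1
      ...       | refl = cong (ctr a) (Finₚ.toℕ-injective (trans b≡0 (sym j≡0)))

      leaf-fixed : ∀ i j k → app σ (leaf i j k) ≡ leaf i j k
      leaf-fixed i j k with Pinned? (leaf i j k)
      ... | yes pinned-k = pinned-fixed pinned-k
      ... | no ¬pinned-k = common-neighbour-fixed σ (ctr-fixed i j) (ctr-fixed i j) cl cl others
        where
        others : ∀ w → E₂ (ctr i j) w → E₂ (ctr i j) w → w ≡ leaf i j k ⊎ app σ w ≡ w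
        others (ctr a b)     _  _ = inj₂ (ctr-fixed a b)
        others (leaf _ _ k′) cl _ with Pinned? (leaf i j k′)
        ... | yes pinned-k′ = inj₂ (pinned-fixed pinned-k′)
        ... | no ¬pinned-k′ = inj₁ (cong (leaf i j) (unpinned-leaves-equal ¬pinned-k′ ¬pinned-k))

      all-fixed : ∀ v → app σ v ≡ v
      all-fixed (ctr  i j)   = ctr-fixed i j
      all-fixed (leaf i j k) = leaf-fixed i j k

    pinned-fixingSetOfSize : FixingSetOfSize (S₂ m p q) (sumFin m λ i → f (p i) (q i))
    pinned-fixingSetOfSize =
      pinned , Uniqueₚ.filter⁺ Pinned? vertices-unique , pinned-length p≥1 , PinnedFixing.all-fixed

    fixIs : FixIs (S₂ m p q) (sumFin m λ i → f (p i) (q i))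
    fixIs = pinned-fixingSetOfSize , λ S _ → lower-bound S₂-embedding p≥1 S

module S₃-Properties (p′ q₁′ q₂′ : ℕ) where

  p q₁ q₂ : ℕ
  p  = suc p′
  q₁ = suc (suc q₁′)
  q₂ = suc q₂′

  open S₂-Properties (pair p (suc p)) (pair q₁ q₂)
    using ( Vertex; _≟_; pinned; ∈-pinned; AtMostOneSingleLeafBlock; EveryCentreHasAnother
          ; pinned-fixingSetOfSize; BlockSymmetry; SymmetricEmbedding; lower-bound )

  G₃ : Graph
  G₃ = S₃ p q₁ q₂

  pair-p≥1 : ∀ i → 1 ≤ pair p (suc p) i
  pair-p≥1 Fin.zero           = s≤s z≤n
  pair-p≥1 (Fin.suc Fin.zero) = s≤s z≤n

  base-injective : ∀ {u v} → _≡_ {A = V G₃} (base u) (base v) → u ≡ v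
  base-injective refl = refl

  base-extension : OnePointExtension (S₂ 2 (pair p (suc p)) (pair q₁ q₂)) G₃
  base-extension = record
    { ι = base ; ι-injective = base-injective
    ; ι-adjacent = λ _ _ → mk⇔ bb λ { (bb uv) → uv }
    ; apex = e ; ι≢apex = λ _ ()
    ; ι-or-apex = λ { (base u) → inj₁ (u , refl) ; e → inj₂ refl } }

  c₁ : Vertex
  c₁ = ctr (Fin.suc Fin.zero) Fin.zero

  c₁-fixed : (σ : Aut G₃) → Fixes σ (map base pinned) → app σ (base c₁) ≡ base c₁
  c₁-fixed σ σ-pinned = unique-neighbour-fixed σ ℓ-fixed (bb lc) λ { _ (bb lc) → refl }
    where
    ℓ : Vertex
    ℓ = leaf (Fin.suc Fin.zero) Fin.zero (Fin.suc Fin.zero)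
    ℓ-fixed : app σ (base ℓ) ≡ base ℓ
    ℓ-fixed = σ-pinned (base ℓ) (∈ₚ.∈-map⁺ base (∈-pinned (inj₁ (s≤s z≤n))))

  c₁≁e : ¬ E G₃ (base c₁) e
  c₁≁e ()

  -- e is the only vertex besides c₁ that is neither a leaf nor adjacent to c₁.
  e-fixed : (σ : Aut G₃) → Fixes σ (map base pinned) → app σ e ≡ e
  e-fixed σ σ-pinned with app σ e in σe≡
  ... | e                 = refl
  ... | base (leaf _ _ _) = ⊥-elim (app-≢-pendant σ (ec {j = Fin.zero}) (ec {j = Fin.suc Fin.zero})
                              (λ ()) (λ { _ (bb lc) → refl }) σe≡)
  ... | base (ctr a b) with ctr a b ≟ c₁
  ...   | yes refl = ⊥-elim (OnePointExtension.ι≢apex base-extension c₁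
                                (sym (app-injective σ (trans σe≡ (sym (c₁-fixed σ σ-pinned))))))
  ...   | no  ≢c₁  = ⊥-elim (c₁≁e (app-adjacent⁻ σ (subst₂ (E G₃) (sym (c₁-fixed σ σ-pinned)) (sym σe≡)
                                        (bb (cc (≢c₁ ∘ sym))))))

  module Lift (s : BlockSymmetry) where
    open BlockSymmetry s

    τ₃ : V G₃ → V G₃
    τ₃ (base v) = base (τ v)
    τ₃ e        = e

    τ₃-involutive : ∀ v → τ₃ (τ₃ v) ≡ v
    τ₃-involutive (base v) = cong base (τ-involutive v)
    τ₃-involutive e        = refl

    τ₃-adjacent : ∀ {u v} → E G₃ u v → E G₃ (τ₃ u) (τ₃ v)
    τ₃-adjacent (bb uv)  = bb (τ-adjacent uv)
    τ₃-adjacent (ec {j}) = subst (λ v → E G₃ e (base v)) (sym (proj₂ (τ-ctr Fin.zero j))) ec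
    τ₃-adjacent (ce {j}) = subst (λ v → E G₃ (base v) e) (sym (proj₂ (τ-ctr Fin.zero j))) ce

    lift₃ : Aut G₃
    lift₃ = involution-aut G₃ τ₃ τ₃-involutive τ₃-adjacent

  _≟₃_ : DecidableEquality (V G₃)
  base u ≟₃ base v with u ≟ v
  ... | yes refl = yes refl
  ... | no  u≢v  = no (u≢v ∘ base-injective)
  base _ ≟₃ e      = no λ ()
  e      ≟₃ base _ = no λ ()
  e      ≟₃ e      = yes refl

  S₃-embedding : SymmetricEmbedding G₃
  S₃-embedding = record
    { ι = base ; ι-injective = base-injective ; _≟G_ = _≟₃_
    ; lift = Lift.lift₃ ; lift-ι = λ _ _ → refl
    ; lift-outside = λ { _ (base u) → inj₁ (u , refl) ; _ e → inj₂ refl } }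

  fixingSetOfSize : FixingSetOfSize G₃ (sumFin 2 λ i → f (pair p (suc p) i) (pair q₁ q₂ i))
  fixingSetOfSize = OnePointExtension.extend-fixingSetOfSize base-extension
    (pinned-fixingSetOfSize pair-p≥1 single-leaf-block-unique another-ctr) e-fixed
    where
    single-leaf-block-unique : AtMostOneSingleLeafBlock
    single-leaf-block-unique {Fin.zero}         {Fin.zero}         _ _ = refl
    single-leaf-block-unique {Fin.zero}         {Fin.suc Fin.zero} _ ()
    single-leaf-block-unique {Fin.suc Fin.zero} ()
    another-ctr : EveryCentreHasAnother
    another-ctr Fin.zero           _ = Fin.suc Fin.zero , Fin.zero , λ ()
    another-ctr (Fin.suc Fin.zero) _ = Fin.zero , Fin.zero , λ ()

  fixIs : FixIs G₃ (sumFin 2 λ i → f (pair p (suc p) i) (pair q₁ q₂ i))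
  fixIs = fixingSetOfSize , λ S _ → lower-bound S₃-embedding pair-p≥1 S

module S₄-Properties (p′ q′ : ℕ) where

  open S₃-Properties p′ 0 q′ using (p; q₂; G₃; pair-p≥1; base-injective; _≟₃_; module Lift)
    renaming (fixingSetOfSize to S₃-fixingSetOfSize)
  open S₂-Properties (pair p (suc p)) (pair 2 q₂)
    using (Pinned; pinned; ∈-pinned; BlockSymmetry; SymmetricEmbedding; lower-bound)

  G₄ : Graph
  G₄ = S₄ p q₂

  old-injective : ∀ {u v} → _≡_ {A = V G₄} (old u) (old v) → u ≡ v
  old-injective refl = refl

  old-extension : OnePointExtension G₃ G₄
  old-extension = record
    { ι = old ; ι-injective = old-injective
    ; ι-adjacent = λ _ _ → mk⇔ oo λ { (oo uv) → uv }
    ; apex = fv ; ι≢apex = λ _ ()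
    ; ι-or-apex = λ { (old u) → inj₁ (u , refl) ; fv → inj₂ refl } }

  pinned-fixed : (σ : Aut G₄) → Fixes σ (map old (map base pinned)) →
                 ∀ {v} → Pinned v → app σ (old (base v)) ≡ old (base v)
  pinned-fixed σ σ-pinned pinned-v =
    σ-pinned _ (∈ₚ.∈-map⁺ old (∈ₚ.∈-map⁺ base (∈-pinned pinned-v)))

  -- fv is the only common neighbour of two pinned leaves in different stars.
  fv-fixed : (σ : Aut G₄) → Fixes σ (map old (map base pinned)) → app σ fv ≡ fv
  fv-fixed σ σ-pinned = common-neighbour-fixed σ
    (pinned-fixed σ σ-pinned {leaf (Fin.suc Fin.zero) Fin.zero (Fin.suc Fin.zero)} (inj₁ (s≤s z≤n)))
    (pinned-fixed σ σ-pinned {leaf Fin.zero (Fin.suc Fin.zero) (fromℕ p′)} last-leaf-pinned)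
    of of λ { (old _) (oo (bb lc)) (oo (bb ())) ; fv _ _ → inj₁ refl }
    where
    last-leaf-pinned : Pinned (leaf Fin.zero (Fin.suc Fin.zero) (fromℕ p′))
    last-leaf-pinned with p′ ℕ.≟ 0
    ... | yes p′≡0 = inj₂ (cong suc p′≡0 , s≤s z≤n)
    ... | no  p′≢0 = inj₁ (subst (1 ≤_) (sym (Finₚ.toℕ-fromℕ p′)) (ℕₚ.n≢0⇒n>0 p′≢0))

  module Lift₄ (s : BlockSymmetry) where
    open Lift s using (τ₃; τ₃-involutive; τ₃-adjacent)

    τ₄ : V G₄ → V G₄
    τ₄ (old v) = old (τ₃ v)
    τ₄ fv      = fv

    τ₄-involutive : ∀ v → τ₄ (τ₄ v) ≡ v
    τ₄-involutive (old v) = cong old (τ₃-involutive v)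
    τ₄-involutive fv      = refl

    τ₄-adjacent : ∀ {u v} → E G₄ u v → E G₄ (τ₄ u) (τ₄ v)
    τ₄-adjacent (oo uv) = oo (τ₃-adjacent uv)
    τ₄-adjacent fo      = fo
    τ₄-adjacent of      = of

    lift₄ : Aut G₄
    lift₄ = involution-aut G₄ τ₄ τ₄-involutive τ₄-adjacent

  _≟₄_ : DecidableEquality (V G₄)
  old u ≟₄ old v with u ≟₃ v
  ... | yes refl = yes refl
  ... | no  u≢v  = no (u≢v ∘ old-injective)
  old _ ≟₄ fv    = no λ ()
  fv    ≟₄ old _ = no λ ()
  fv    ≟₄ fv    = yes refl

  S₄-embedding : SymmetricEmbedding G₄
  S₄-embedding = record
    { ι = old ∘ base ; ι-injective = base-injective ∘ old-injective ; _≟G_ = _≟₄_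
    ; lift = Lift₄.lift₄ ; lift-ι = λ _ _ → refl
    ; lift-outside = λ { _ (old (base u)) → inj₁ (u , refl) ; _ (old e) → inj₂ refl ; _ fv → inj₂ refl } }

  fixIs : FixIs G₄ (sumFin 2 λ i → f (pair p (suc p) i) (pair 2 q₂ i))
  fixIs = OnePointExtension.extend-fixingSetOfSize old-extension S₃-fixingSetOfSize fv-fixed ,
          λ S _ → lower-bound S₄-embedding pair-p≥1 S

fixIs-S : ∀ p q → 1 ≤ p → 2 ≤ q → FixIs (S p q) (f p q)
fixIs-S p (suc zero)     _   (s≤s ())
fixIs-S p (suc (suc q′)) 1≤p _ = subst (FixIs (S p (suc (suc q′)))) (ℕₚ.+-identityʳ _)
  (S₂-Properties.fixIs (λ _ → p) (λ _ → suc (suc q′)) (λ _ → 1≤p) single-leaf-block-unique another-ctr)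
  where
  open S₂-Properties {1} (λ _ → p) (λ _ → suc (suc q′)) using (AtMostOneSingleLeafBlock; EveryCentreHasAnother)
  single-leaf-block-unique : AtMostOneSingleLeafBlock
  single-leaf-block-unique {Fin.zero} {Fin.zero} _ _ = refl
  another-ctr : EveryCentreHasAnother
  another-ctr Fin.zero Fin.zero    = Fin.zero , Fin.suc Fin.zero , λ ()
  another-ctr Fin.zero (Fin.suc _) = Fin.zero , Fin.zero , λ ()

fixIs-S₂ : ∀ m (p q : Fin m → ℕ) → 2 ≤ m → (∀ i j → i Fin.< j → p j < p i) →
           (∀ i → 1 ≤ p i) → (∀ i → 1 ≤ q i) → FixIs (S₂ m p q) (sumFin m λ i → f (p i) (q i))
fixIs-S₂ (suc zero)     p q (s≤s ()) _ _ _
fixIs-S₂ (suc (suc m′)) p q _ p-decreasing p≥1 q≥1 =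
  S₂-Properties.fixIs p q p≥1 single-leaf-block-unique another-ctr
  where
  open S₂-Properties p q using (AtMostOneSingleLeafBlock; EveryCentreHasAnother)
  single-leaf-block-unique : AtMostOneSingleLeafBlock
  single-leaf-block-unique {i} {i′} p≡1 p′≡1 with Finₚ.<-cmp i i′
  ... | tri< i<i′ _ _ = ⊥-elim (ℕₚ.<-irrefl (trans p′≡1 (sym p≡1)) (p-decreasing i i′ i<i′))
  ... | tri≈ _ i≡i′ _ = i≡i′
  ... | tri> _ _ i′<i = ⊥-elim (ℕₚ.<-irrefl (trans p≡1 (sym p′≡1)) (p-decreasing i′ i i′<i))
  another-ctr : EveryCentreHasAnother
  another-ctr Fin.zero    _ = Fin.suc Fin.zero , fromℕ< (q≥1 (Fin.suc Fin.zero)) , λ ()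
  another-ctr (Fin.suc _) _ = Fin.zero , fromℕ< (q≥1 Fin.zero) , λ ()

fixIs-S₃ : ∀ p q₁ q₂ → 1 ≤ p → 2 ≤ q₁ → 1 ≤ q₂ → FixIs (S₃ p q₁ q₂) (f p q₁ + f (suc p) q₂)
fixIs-S₃ (suc p′) (suc zero)       (suc q₂′) _ (s≤s ()) _
fixIs-S₃ (suc p′) (suc (suc q₁′)) (suc q₂′) _ _ _ =
  subst (FixIs _) (cong (f (suc p′) (suc (suc q₁′)) +_) (ℕₚ.+-identityʳ _)) (S₃-Properties.fixIs p′ q₁′ q₂′)

fixIs-S₄ : ∀ p q → 1 ≤ p → 1 ≤ q → FixIs (S₄ p q) (f p 2 + f (suc p) q)
fixIs-S₄ (suc p′) (suc q′) _ _ =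
  subst (FixIs _) (cong (f (suc p′) 2 +_) (ℕₚ.+-identityʳ _)) (S₄-Properties.fixIs p′ q′)

mainTheorem7 :
    (∀ (p q : ℕ) → 1 ≤ p → 2 ≤ q → FixIs (S p q) (f p q))
    × (∀ (m : ℕ) (p q : Fin m → ℕ) → 2 ≤ m
         → (∀ (i j : Fin m) → i Data.Fin.< j → p j < p i)
         → (∀ i → 1 ≤ p i) → (∀ i → 1 ≤ q i)
         → FixIs (S₂ m p q) (sumFin m (λ i → f (p i) (q i))))
    × (∀ (p q₁ q₂ : ℕ) → 1 ≤ p → 2 ≤ q₁ → 1 ≤ q₂
         → FixIs (S₃ p q₁ q₂) (f p q₁ + f (suc p) q₂))
    × (∀ (p q : ℕ) → 1 ≤ p → 1 ≤ q
         → FixIs (S₄ p q) (f p 2 + f (suc p) q))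
mainTheorem7 = fixIs-S , fixIs-S₂ , fixIs-S₃ , fixIs-S₄
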